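{- Let $ab$ and $cd$ be chords of $C_n$ and let $W=e_1\dots e_k$ be a link path from $a$ to $b$. If $ab$ crosses $cd$, then some chord of $W$ crosses $cd$.
   Context: Let $n\ge 4$ and let $C_n$ be the cycle on $[n]$ with edges $\{i,i+1\}$ and $\{n,1\}$. A chord is an edge between two non-consecutive vertices of $C_n$. Chords $ab$, $cd$ with $a<b$, $c<d$ cross if $a,b,c,d$ are distinct and $c<a<d<b$ or $a<c<b<d$. A link path from vertex $a$ to vertex $b$ is a sequence $e_1e_2\dots e_k$ ($k\ge1$) of chords such that $a$ is an endpoint of $e_1$, $b$ is an endpoint of $e_k$, and $e_i$ crosses $e_{i+1}$ for each $i<k$. -}

module Defs where

open import Data.Nat using (ℕ; suc; _<_; _≤_)
open import Data.Product using (_×_)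
open import Data.Sum using (_⊎_)
open import Data.List.NonEmpty using (List⁺; head; last; toList)
open import Data.List.Relation.Unary.Linked using (Linked)
open import Relation.Binary.PropositionalEquality using (_≡_)
open import Relation.Nullary using (¬_)

-- A chord of C_n (vertices 1..n, edges {i,i+1} and {n,1}),
-- written with its endpoints ordered: lo < hi.
-- Non-consecutive: not {i,i+1} and not {1,n}.
record Chord (n : ℕ) : Set where
  constructor chord
  field
    lo hi  : ℕ
    1≤lo   : 1 ≤ lo
    lo<hi  : lo < hi
    hi≤n   : hi ≤ n
    notAdj : ¬ (hi ≡ suc lo)
    notWrap : ¬ ((lo ≡ 1) × (hi ≡ n))
open Chord public

-- Chords ab, cd (a<b, c<d) cross iff a,b,c,d distinct and c<a<d<b or a<c<b<d.
-- (distinctness is implied by the strict chains, but stated for fidelity)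
Distinct4 : ℕ → ℕ → ℕ → ℕ → Set
Distinct4 a b c d =
  ¬ (a ≡ b) × ¬ (a ≡ c) × ¬ (a ≡ d) × ¬ (b ≡ c) × ¬ (b ≡ d) × ¬ (c ≡ d)

Crosses : ∀ {n} → Chord n → Chord n → Set
Crosses e f =
  Distinct4 (lo e) (hi e) (lo f) (hi f) ×
  ( (lo f < lo e × lo e < hi f × hi f < hi e)
  ⊎ (lo e < lo f × lo f < hi e × hi e < hi f))

IsEndpoint : ∀ {n} → ℕ → Chord n → Set
IsEndpoint v e = (v ≡ lo e) ⊎ (v ≡ hi e)

record IsLinkPath {n : ℕ} (a b : ℕ) (W : List⁺ (Chord n)) : Set where
  field
    startAt : IsEndpoint a (head W)
    endAt   : IsEndpoint b (last W)
    linked  : Linked Crosses (toList W)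

-- A chord with an endpoint strictly on one side of cd that does not cross cd
-- lies in the closed arc of that side, so every chord crossing it has an
-- endpoint strictly on the same side. Hence a link path starting at a vertex
-- strictly on one side of cd stays there until one of its chords crosses cd;
-- if none did, its last chord would join that side to the other side, where
-- the end vertex lies, and so would cross cd after all.
module Submission where

open import Defs
open import Data.Nat using (ℕ; _≤_; _<_; _<?_)
open import Data.Nat.Properties using (<⇒≢; >⇒≢; <⇒≤; ≮⇒≥; <-trans; <-asym; ≤-<-trans; <-≤-trans)
open import Data.Empty using (⊥; ⊥-elim)
open import Data.List using ([]; _∷_)
open import Data.List.NonEmpty using (List⁺; toList; last; snocView; _∷ʳ′_) renaming (_∷_ to _∷⁺_)
open import Data.List.Membership.Propositional using (_∈_; lose)
open import Data.List.Membership.Propositional.Properties using (∈-++⁺ʳ)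
open import Data.List.Relation.Unary.All using (All; []; _∷_; lookup)
open import Data.List.Relation.Unary.Any using (Any; here; there)
open import Data.List.Relation.Unary.Linked using (Linked; _∷_)
open import Data.Product using (_×_; _,_)
open import Data.Sum using (_⊎_; inj₁; inj₂; [_,_]′) renaming (map to ⊎-map; map₂ to ⊎-map₂; swap to ⊎-swap)
open import Function using (flip; id)
open import Level using (0ℓ)
open import Relation.Binary.PropositionalEquality using (refl; ≢-sym)
open import Relation.Nullary using (yes; no)
open import Relation.Unary using (Pred; _⊆_)

last∈toList : ∀ {A : Set} (xs : List⁺ A) → last xs ∈ toList xs
last∈toList xs with snocView xs
... | []       ∷ʳ′ x = here refl
... | (y ∷ ys) ∷ʳ′ x = there (∈-++⁺ʳ ys (here refl))

module _ {A : Set} {R : A → A → Set} {P Q : Pred A 0ℓ}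
         (step : ∀ {x y} → P x → R x y → Q x ⊎ P y) where

  linked-any⊎all : ∀ {x xs} → P x → Linked R (x ∷ xs) → Any Q (x ∷ xs) ⊎ All P (x ∷ xs)
  linked-any⊎all {xs = []} px _ = inj₂ (px ∷ [])
  linked-any⊎all {xs = y ∷ ys} px (rxy ∷ rest) with step px rxy
  ... | inj₁ qx = inj₁ (here qx)
  ... | inj₂ py = ⊎-map there (px ∷_) (linked-any⊎all py rest)

module _ {n : ℕ} where

  data Interior (e : Chord n) (v : ℕ) : Set where
    interior : lo e < v → v < hi e → Interior e v

  data Exterior (e : Chord n) (v : ℕ) : Set where
    <lo : v < lo e → Exterior e v
    hi< : hi e < v → Exterior e v

  data Arc (e : Chord n) (v : ℕ) : Set where
    arc : lo e ≤ v → v ≤ hi e → Arc e v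

  data CoArc (e : Chord n) (v : ℕ) : Set where
    ≤lo : v ≤ lo e → CoArc e v
    hi≤ : hi e ≤ v → CoArc e v

  data EndpointIn (X : Pred ℕ 0ℓ) (e : Chord n) : Set where
    lo∈ : X (lo e) → EndpointIn X e
    hi∈ : X (hi e) → EndpointIn X e

  endpointIn : ∀ {X v e} → IsEndpoint v e → X v → EndpointIn X e
  endpointIn (inj₁ refl) x = lo∈ x
  endpointIn (inj₂ refl) x = hi∈ x

  endpointIn-mono : ∀ {X Y} → X ⊆ Y → EndpointIn X ⊆ EndpointIn Y
  endpointIn-mono X⊆Y (lo∈ x) = lo∈ (X⊆Y x)
  endpointIn-mono X⊆Y (hi∈ x) = hi∈ (X⊆Y x)

  interior⇒arc : ∀ {e} → Interior e ⊆ Arc e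
  interior⇒arc (interior p q) = arc (<⇒≤ p) (<⇒≤ q)

  exterior⇒coArc : ∀ {e} → Exterior e ⊆ CoArc e
  exterior⇒coArc (<lo p) = ≤lo (<⇒≤ p)
  exterior⇒coArc (hi< p) = hi≤ (<⇒≤ p)

  interior⊎coArc : ∀ e v → Interior e v ⊎ CoArc e v
  interior⊎coArc e v with lo e <? v | v <? hi e
  ... | yes p | yes q = inj₁ (interior p q)
  ... | no p  | _     = inj₂ (≤lo (≮⇒≥ p))
  ... | yes _ | no q  = inj₂ (hi≤ (≮⇒≥ q))

  exterior⊎arc : ∀ e v → Exterior e v ⊎ Arc e v
  exterior⊎arc e v with v <? lo e | hi e <? v
  ... | yes p | _     = inj₁ (<lo p)
  ... | no _  | yes q = inj₁ (hi< q)
  ... | no p  | no q  = inj₂ (arc (≮⇒≥ p) (≮⇒≥ q))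

  interior∩exterior≡∅ : ∀ {e v} → Interior e v → Exterior e v → ⊥
  interior∩exterior≡∅ (interior p _) (<lo r) = <-asym p r
  interior∩exterior≡∅ (interior _ q) (hi< r) = <-asym q r

  Separated : Chord n → Pred (Chord n) 0ℓ
  Separated f e = (Interior f (lo e) × Exterior f (hi e))
                ⊎ (Exterior f (lo e) × Interior f (hi e))

  crosses-sym : ∀ {e f : Chord n} → Crosses e f → Crosses f e
  crosses-sym ((a≢b , a≢c , a≢d , b≢c , b≢d , c≢d) , order) =
    (c≢d , ≢-sym a≢c , ≢-sym b≢c , ≢-sym a≢d , ≢-sym b≢d , a≢b) , ⊎-swap order

  crosses⇒separated : ∀ {e f} → Crosses e f → Separated f e
  crosses⇒separated (_ , inj₁ (p , q , r)) = inj₁ (interior p q , hi< r)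
  crosses⇒separated (_ , inj₂ (p , q , r)) = inj₂ (<lo p , interior q r)

  separated⇒crosses : ∀ {e f} → Separated f e → Crosses e f
  separated⇒crosses {e} (inj₁ (interior p _ , <lo r)) = ⊥-elim (<-asym (lo<hi e) (<-trans r p))
  separated⇒crosses (inj₁ (interior p q , hi< r)) =
    (<⇒≢ (<-trans q r) , >⇒≢ p , <⇒≢ q , >⇒≢ (<-trans p (<-trans q r)) , >⇒≢ r , <⇒≢ (<-trans p q)) ,
    inj₁ (p , q , r)
  separated⇒crosses (inj₂ (<lo p , interior q r)) =
    (<⇒≢ (<-trans p q) , <⇒≢ p , <⇒≢ (<-trans p (<-trans q r)) , >⇒≢ q , <⇒≢ r , <⇒≢ (<-trans q r)) ,
    inj₂ (p , q , r)
  separated⇒crosses {e} (inj₂ (hi< p , interior _ r)) = ⊥-elim (<-asym r (<-trans p (lo<hi e)))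

  interior-exterior⇒crosses : ∀ {e f} → EndpointIn (Interior f) e → EndpointIn (Exterior f) e →
    Crosses e f
  interior-exterior⇒crosses {e} {f} (lo∈ lo-in) (hi∈ hi-out) =
    separated⇒crosses {e} {f} (inj₁ (lo-in , hi-out))
  interior-exterior⇒crosses {e} {f} (hi∈ hi-in) (lo∈ lo-out) =
    separated⇒crosses {e} {f} (inj₂ (lo-out , hi-in))
  interior-exterior⇒crosses (lo∈ lo-in) (lo∈ lo-out) = ⊥-elim (interior∩exterior≡∅ lo-in lo-out)
  interior-exterior⇒crosses (hi∈ hi-in) (hi∈ hi-out) = ⊥-elim (interior∩exterior≡∅ hi-in hi-out)

  crosses⇒endpointIn-interior : ∀ {e f} → Crosses e f → EndpointIn (Interior e) f
  crosses⇒endpointIn-interior {e} {f} e×f with crosses⇒separated {f} {e} (crosses-sym {e} {f} e×f)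
  ... | inj₁ (lo-in , _) = lo∈ lo-in
  ... | inj₂ (_ , hi-in) = hi∈ hi-in

  crosses⇒endpointIn-exterior : ∀ {e f} → Crosses e f → EndpointIn (Exterior e) f
  crosses⇒endpointIn-exterior {e} {f} e×f with crosses⇒separated {f} {e} (crosses-sym {e} {f} e×f)
  ... | inj₁ (_ , hi-out) = hi∈ hi-out
  ... | inj₂ (lo-out , _) = lo∈ lo-out

  endpointIn-interior⇒crosses⊎arc : ∀ {e f} → EndpointIn (Interior f) e →
    Crosses e f ⊎ (Arc f (lo e) × Arc f (hi e))
  endpointIn-interior⇒crosses⊎arc {e} {f} (lo∈ lo-in) with exterior⊎arc f (hi e)
  ... | inj₁ hi-out = inj₁ (interior-exterior⇒crosses {e} {f} (lo∈ lo-in) (hi∈ hi-out))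
  ... | inj₂ hi-arc = inj₂ (interior⇒arc lo-in , hi-arc)
  endpointIn-interior⇒crosses⊎arc {e} {f} (hi∈ hi-in) with exterior⊎arc f (lo e)
  ... | inj₁ lo-out = inj₁ (interior-exterior⇒crosses {e} {f} (hi∈ hi-in) (lo∈ lo-out))
  ... | inj₂ lo-arc = inj₂ (lo-arc , interior⇒arc hi-in)

  endpointIn-exterior⇒crosses⊎coArc : ∀ {e f} → EndpointIn (Exterior f) e →
    Crosses e f ⊎ (CoArc f (lo e) × CoArc f (hi e))
  endpointIn-exterior⇒crosses⊎coArc {e} {f} (lo∈ lo-out) with interior⊎coArc f (hi e)
  ... | inj₁ hi-in    = inj₁ (interior-exterior⇒crosses {e} {f} (hi∈ hi-in) (lo∈ lo-out))
  ... | inj₂ hi-coArc = inj₂ (exterior⇒coArc lo-out , hi-coArc)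
  endpointIn-exterior⇒crosses⊎coArc {e} {f} (hi∈ hi-out) with interior⊎coArc f (lo e)
  ... | inj₁ lo-in    = inj₁ (interior-exterior⇒crosses {e} {f} (lo∈ lo-in) (hi∈ hi-out))
  ... | inj₂ lo-coArc = inj₂ (lo-coArc , exterior⇒coArc hi-out)

  arc⇒interior⊆interior : ∀ {e f} → Arc f (lo e) → Arc f (hi e) → Interior e ⊆ Interior f
  arc⇒interior⊆interior (arc l _) (arc _ h) (interior p q) = interior (≤-<-trans l p) (<-≤-trans q h)

  coArc⇒interior⊆exterior⊎exterior⊆exterior : ∀ {e f} → CoArc f (lo e) → CoArc f (hi e) →
    Interior e ⊆ Exterior f ⊎ Exterior e ⊆ Exterior f
  coArc⇒interior⊆exterior⊎exterior⊆exterior (≤lo _) (≤lo h) =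
    inj₁ λ { (interior _ q) → <lo (<-≤-trans q h) }
  coArc⇒interior⊆exterior⊎exterior⊆exterior (≤lo l) (hi≤ h) =
    inj₂ λ { (<lo p) → <lo (<-≤-trans p l) ; (hi< q) → hi< (≤-<-trans h q) }
  coArc⇒interior⊆exterior⊎exterior⊆exterior {e} {f} (hi≤ l) (≤lo h) =
    ⊥-elim (<-asym (lo<hi f) (≤-<-trans l (<-≤-trans (lo<hi e) h)))
  coArc⇒interior⊆exterior⊎exterior⊆exterior (hi≤ l) (hi≤ _) =
    inj₁ λ { (interior p _) → hi< (≤-<-trans l p) }

  interior-step : ∀ {cd e f} → EndpointIn (Interior cd) e → Crosses e f →
    Crosses e cd ⊎ EndpointIn (Interior cd) f
  interior-step {cd} {e} {f} e-in e×f = ⊎-map₂ same-side (endpointIn-interior⇒crosses⊎arc e-in)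
    where
    same-side : Arc cd (lo e) × Arc cd (hi e) → EndpointIn (Interior cd) f
    same-side (l , h) =
      endpointIn-mono (arc⇒interior⊆interior l h) (crosses⇒endpointIn-interior {e} {f} e×f)

  exterior-step : ∀ {cd e f} → EndpointIn (Exterior cd) e → Crosses e f →
    Crosses e cd ⊎ EndpointIn (Exterior cd) f
  exterior-step {cd} {e} {f} e-out e×f = ⊎-map₂ same-side (endpointIn-exterior⇒crosses⊎coArc e-out)
    where
    same-side : CoArc cd (lo e) × CoArc cd (hi e) → EndpointIn (Exterior cd) f
    same-side (l , h) with coArc⇒interior⊆exterior⊎exterior⊆exterior l h
    ... | inj₁ int⊆ext = endpointIn-mono int⊆ext (crosses⇒endpointIn-interior {e} {f} e×f)
    ... | inj₂ ext⊆ext = endpointIn-mono ext⊆ext (crosses⇒endpointIn-exterior {e} {f} e×f)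

module _ {n : ℕ} {cd : Chord n} {X Y : Pred ℕ 0ℓ}
         (step : ∀ {e f} → EndpointIn X e → Crosses e f → Crosses e cd ⊎ EndpointIn X f)
         (opposite⇒crosses : ∀ {e} → EndpointIn X e → EndpointIn Y e → Crosses e cd) where

  linkPath-crosses : ∀ {a b W} → IsLinkPath a b W → X a → Y b →
    Any (λ e → Crosses e cd) (toList W)
  linkPath-crosses {W = e ∷⁺ es} lp a∈X b∈Y =
    [ id , last-crosses ]′ (linked-any⊎all step (endpointIn startAt a∈X) linked)
    where
    open IsLinkPath lp
    last∈W : last (e ∷⁺ es) ∈ e ∷ es
    last∈W = last∈toList (e ∷⁺ es)
    last-crosses : All (EndpointIn X) (e ∷ es) → Any (λ g → Crosses g cd) (e ∷ es)
    last-crosses all-X = lose last∈W (opposite⇒crosses (lookup all-X last∈W) (endpointIn endAt b∈Y))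

lemma4 : (n : ℕ) → 4 ≤ n → (ab cd : Chord n) (W : List⁺ (Chord n)) →
    IsLinkPath (lo ab) (hi ab) W →
    Crosses ab cd →
    Any (λ e → Crosses e cd) (toList W)
lemma4 _ _ ab cd _ lp ab×cd with crosses⇒separated {e = ab} {f = cd} ab×cd
... | inj₁ (a-in , b-out) =
  linkPath-crosses {cd = cd} interior-step interior-exterior⇒crosses lp a-in b-out
... | inj₂ (a-out , b-in) =
  linkPath-crosses {cd = cd} exterior-step (flip interior-exterior⇒crosses) lp a-out b-in
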